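{- Let $\mathbb{F}_q$ be the finite field with $q$ elements and let $A\subset\mathbb{F}_q$ be any subset. If $|A|\not\equiv 2\pmod 3$, then there is a subset $S\subset A$ which is symmetric or antisymmetric and satisfies $|S|\geqslant\frac{2}{3}|A|$. If $|A|\equiv 2\pmod 3$, then there is a subset $S\subset A$ which is symmetric or antisymmetric and satisfies $|S|\geqslant\frac{2}{3}|A|-\frac{1}{3}$.
   Context: For $X\subset\mathbb{F}_q$, $-X=\{ -x:x\in X\}$. A set $X$ is symmetric if $X=-X$, and antisymmetric if $X\cap(-X)=\emptyset$. -}

module Defs where

open import Level using (0ℓ)
open import Data.Nat using (ℕ)
open import Data.Fin using (Fin)
open import Data.Fin.Subset using (Subset; _∈_)
open import Data.Product using (Σ; ∃; _×_; _,_)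
open import Relation.Nullary using (¬_)
open import Relation.Binary.PropositionalEquality using (_≡_)
import Algebra.Structures as AS

-- A finite field with q elements, with carrier identified with Fin q
-- (every finite field of order q is isomorphic to such a structure).
record FiniteField (q : ℕ) : Set where
  field
    _+_ _*_ : Fin q → Fin q → Fin q
    -_      : Fin q → Fin q
    0# 1#   : Fin q
    isCommutativeRing : AS.IsCommutativeRing {A = Fin q} _≡_ _+_ _*_ -_ 0# 1#
    0≢1     : ¬ (0# ≡ 1#)
    inverse : ∀ x → ¬ (x ≡ 0#) → ∃ λ y → x * y ≡ 1#
  infixl 6 _+_
  infixl 7 _*_

module _ {q : ℕ} (F : FiniteField q) where
  open FiniteField F

  _∈Neg_ : Fin q → Subset q → Set
  y ∈Neg X = ∃ λ x → x ∈ X × y ≡ - x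

  Symmetric : Subset q → Set
  Symmetric X = ∀ y → (y ∈ X → y ∈Neg X) × (y ∈Neg X → y ∈ X)

  Antisymmetric : Subset q → Set
  Antisymmetric X = ∀ y → y ∈ X → ¬ (y ∈Neg X)

module Submission where

-- Split A ⊆ 𝔽_q according to the involution x ↦ -x.  The core
-- C = A ∩ (-A) is symmetric.  The half H, consisting of the x ∈ A with
-- -x ∉ A together with the smaller element (in the numbering of 𝔽_q by
-- Fin q) of every pair {x, -x} ⊆ A with x ≠ -x, is antisymmetric.
-- Counting each element of A gives the exchange identity
--     |C| + 2|H| + e = 2|A|,
-- where e counts the fixed points x = -x lying in A.  In odd
-- characteristic e ≤ 1 (only 0 is fixed), so max(|C|, |H|) ≥ (2|A| - 1)/3,
-- and divisibility by 3 rounds this up to 2|A|/3 unless |A| ≡ 2 (mod 3).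
-- In characteristic 2 negation is the identity and A itself is symmetric.

open import Defs
open import Data.Nat using (ℕ; _*_; _≤_; _∸_; _%_)
open import Data.Fin.Subset using (Subset; _⊆_; ∣_∣)
open import Data.Product using (Σ; _×_)
open import Data.Sum using (_⊎_)
open import Relation.Nullary using (¬_)
open import Relation.Binary.PropositionalEquality using (_≡_)

open import Data.Nat using (zero; suc; _+_; _<_; _<ᵇ_; _≡ᵇ_; s≤s)
open import Data.Nat.Properties
  using (+-*-semiring; *-comm; ≤-total; ≤-trans; +-monoʳ-≤; +-monoˡ-≤; *-monoʳ-≤; *-monoˡ-≤;
         ∸-monoʳ-≤; m+n∸n≡m; m≤n+m∸n; m∸n≤m; n≤1+n; m≤n⇒m<n∨m≡n; m<1+n⇒m≤n; +-cancelʳ-≡;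
         <-asym; <ᵇ⇒<; ≡ᵇ⇒≡; module ≤-Reasoning)
open import Data.Nat.DivMod using (%-distribˡ-*; m%n<n; [m+kn]%n≡m%n)
open import Data.Bool using (Bool; true; false; _∧_; _∨_; not; T)
open import Data.Bool.Properties using (T-≡; T-∧; ∧-comm)
open import Data.Fin using (Fin; toℕ; _≟_)
open import Data.Fin.Properties using (toℕ-injective)
open import Data.Fin.Subset using (_∈_; ⁅_⁆)
open import Data.Fin.Subset.Properties using (p⊆q⇒∣p∣≤∣q∣; ∣⁅x⁆∣≡1; x∈⁅x⁆)
open import Data.Fin.Permutation using (permutation)
open import Data.Vec using (lookup; tabulate)
open import Data.Vec.Properties using (lookup∘tabulate; tabulate∘lookup; []=⇒lookup; lookup⇒[]=)
open import Data.Product using (_,_; proj₁; proj₂)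
open import Data.Sum using (inj₁; inj₂)
import Data.Sum as Sum
open import Data.Empty using (⊥)
open import Function using (_∘_; Equivalence)
open import Level using (0ℓ)
open import Relation.Nullary using (yes; no; contradiction)
open import Relation.Binary.PropositionalEquality using (refl; sym; trans; cong; cong₂; subst; module ≡-Reasoning)
open import Algebra.Bundles using (CommutativeRing)
open import Algebra.Structures using (IsCommutativeRing)
open import Algebra.Properties.Semiring.Sum +-*-semiring
  using (sum; ∑-distrib-+; sum-permute; sum-cong-≗; *-distribˡ-sum)

open Equivalence using (to; from)

ι : Bool → ℕ
ι true  = 1
ι false = 0

#_ : ∀ {n} → (Fin n → Bool) → ℕ
# f = sum (ι ∘ f)

∣tabulate∣ : ∀ {n} (f : Fin n → Bool) → ∣ tabulate f ∣ ≡ # f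
∣tabulate∣ {zero}  f = refl
∣tabulate∣ {suc n} f with f Fin.zero
... | true  = cong suc (∣tabulate∣ (f ∘ Fin.suc))
... | false = ∣tabulate∣ (f ∘ Fin.suc)

∈⇒T : ∀ {n} {p : Subset n} {x : Fin n} → x ∈ p → T (lookup p x)
∈⇒T x∈p = from T-≡ ([]=⇒lookup x∈p)

T⇒∈ : ∀ {n} {p : Subset n} {x : Fin n} → T (lookup p x) → x ∈ p
T⇒∈ {p = p} {x} t = lookup⇒[]= x p (to T-≡ t)

∈-tabulate⁻ : ∀ {n} {f : Fin n → Bool} {x : Fin n} → x ∈ tabulate f → T (f x)
∈-tabulate⁻ {f = f} {x} x∈ = subst T (lookup∘tabulate f x) (∈⇒T x∈)

∈-tabulate⁺ : ∀ {n} {f : Fin n → Bool} {x : Fin n} → T (f x) → x ∈ tabulate f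
∈-tabulate⁺ {f = f} {x} t = T⇒∈ (subst T (sym (lookup∘tabulate f x)) t)

-- Linearity of summation, in the shape needed to sum the pointwise exchange identity.
sum-balance : ∀ {n} (a b c d e f : Fin n → ℕ) →
  (∀ i → a i + 2 * b i + c i + d i ≡ 2 * e i + f i) →
  sum a + 2 * sum b + sum c + sum d ≡ 2 * sum e + sum f
sum-balance a b c d e f pointwise = begin
  sum a + 2 * sum b + sum c + sum d
    ≡⟨ cong (λ s → sum a + s + sum c + sum d) (*-distribˡ-sum 2 b) ⟩
  sum a + sum (λ i → 2 * b i) + sum c + sum d
    ≡⟨ cong (λ s → s + sum c + sum d) (sym (∑-distrib-+ a (λ i → 2 * b i))) ⟩
  sum (λ i → a i + 2 * b i) + sum c + sum d
    ≡⟨ cong (_+ sum d) (sym (∑-distrib-+ (λ i → a i + 2 * b i) c)) ⟩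
  sum (λ i → a i + 2 * b i + c i) + sum d
    ≡⟨ sym (∑-distrib-+ (λ i → a i + 2 * b i + c i) d) ⟩
  sum (λ i → a i + 2 * b i + c i + d i)
    ≡⟨ sum-cong-≗ pointwise ⟩
  sum (λ i → 2 * e i + f i)
    ≡⟨ ∑-distrib-+ (λ i → 2 * e i) f ⟩
  sum (λ i → 2 * e i) + sum f
    ≡⟨ cong (_+ sum f) (sym (*-distribˡ-sum 2 e)) ⟩
  2 * sum e + sum f ∎
  where open ≡-Reasoning

both-guards : ∀ p r b c → T (p ∧ (not r ∨ b)) → T (r ∧ (not p ∨ c)) → T b × T c
both-guards true  true  b c tb tc = tb , tc
both-guards false r     b c () _
both-guards true  false b c _  ()

-- Each element of A contributes equally to both sides of the exchange identity:
-- here p, r say whether x and its partner lie in A, and m, k are their indices.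
balance-at : ∀ p r m k →
  ι (p ∧ r) + 2 * ι (p ∧ (not r ∨ (m <ᵇ k))) + ι ((p ∧ r) ∧ (m ≡ᵇ k)) + ι ((p ∧ r) ∧ (k <ᵇ m))
    ≡ 2 * ι p + ι ((p ∧ r) ∧ (m <ᵇ k))
balance-at false r     m       k       = refl
balance-at true  false m       k       = refl
balance-at true  true  zero    zero    = refl
balance-at true  true  zero    (suc k) = refl
balance-at true  true  (suc m) zero    = refl
balance-at true  true  (suc m) (suc k) = balance-at true true m k

module InvolutionSplit {n : ℕ} (σ : Fin n → Fin n) (σ-involutive : ∀ x → σ (σ x) ≡ x)
                       (A : Subset n) where

  inA : Fin n → Bool
  inA = lookup A

  paired : Fin n → Bool
  paired x = inA x ∧ inA (σ x)

  below above fixed : Fin n → Bool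
  below x = toℕ x <ᵇ toℕ (σ x)
  above x = toℕ (σ x) <ᵇ toℕ x
  fixed x = toℕ x ≡ᵇ toℕ (σ x)

  chosen : Fin n → Bool
  chosen x = inA x ∧ (not (inA (σ x)) ∨ below x)

  pairedBelow pairedAbove pairedFixed : Fin n → Bool
  pairedBelow x = paired x ∧ below x
  pairedAbove x = paired x ∧ above x
  pairedFixed x = paired x ∧ fixed x

  Core Half FixedCore : Subset n
  Core      = tabulate paired
  Half      = tabulate chosen
  FixedCore = tabulate pairedFixed

  paired-σ : ∀ x → paired (σ x) ≡ paired x
  paired-σ x rewrite σ-involutive x = ∧-comm (inA (σ x)) (inA x)

  chosen-σ : ∀ x → chosen (σ x) ≡ inA (σ x) ∧ (not (inA x) ∨ above x)
  chosen-σ x rewrite σ-involutive x = refl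

  above-σ : ∀ x → pairedAbove (σ x) ≡ pairedBelow x
  above-σ x rewrite σ-involutive x = cong (_∧ below x) (∧-comm (inA (σ x)) (inA x))

  Core⊆A : Core ⊆ A
  Core⊆A x∈ = T⇒∈ (proj₁ (to T-∧ (∈-tabulate⁻ x∈)))

  Half⊆A : Half ⊆ A
  Half⊆A x∈ = T⇒∈ (proj₁ (to T-∧ (∈-tabulate⁻ x∈)))

  Core-closed : ∀ {x} → x ∈ Core → σ x ∈ Core
  Core-closed {x} x∈ = ∈-tabulate⁺ (subst T (sym (paired-σ x)) (∈-tabulate⁻ x∈))

  -- If x and σ x were both chosen, each would be smaller than the other.
  Half-disjoint : ∀ {x} → x ∈ Half → σ x ∈ Half → ⊥
  Half-disjoint {x} x∈ σx∈ =
    <-asym (<ᵇ⇒< (toℕ x) (toℕ (σ x)) (proj₁ guards)) (<ᵇ⇒< (toℕ (σ x)) (toℕ x) (proj₂ guards))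
    where
    guards : T (below x) × T (above x)
    guards = both-guards (inA x) (inA (σ x)) (below x) (above x)
               (∈-tabulate⁻ x∈) (subst T (chosen-σ x) (∈-tabulate⁻ σx∈))

  FixedCore-≤1 : (c : Fin n) → (∀ x → σ x ≡ x → x ≡ c) → ∣ FixedCore ∣ ≤ 1
  FixedCore-≤1 c only-fixed = subst (∣ FixedCore ∣ ≤_) (∣⁅x⁆∣≡1 c) (p⊆q⇒∣p∣≤∣q∣ FixedCore⊆⁅c⁆)
    where
    FixedCore⊆⁅c⁆ : FixedCore ⊆ ⁅ c ⁆
    FixedCore⊆⁅c⁆ {x} x∈ = subst (_∈ ⁅ c ⁆) (sym (only-fixed x σx≡x)) (x∈⁅x⁆ c)
      where
      σx≡x : σ x ≡ x
      σx≡x = sym (toℕ-injective (≡ᵇ⇒≡ _ _ (proj₂ (to T-∧ (∈-tabulate⁻ x∈)))))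

  #above≡#below : # pairedAbove ≡ # pairedBelow
  #above≡#below = trans (sum-permute (ι ∘ pairedAbove) π) (sum-cong-≗ (cong ι ∘ above-σ))
    where π = permutation σ σ σ-involutive σ-involutive

  balance : # paired + 2 * # chosen + # pairedFixed + # pairedAbove ≡ 2 * # inA + # pairedBelow
  balance = sum-balance (ι ∘ paired) (ι ∘ chosen) (ι ∘ pairedFixed) (ι ∘ pairedAbove)
                        (ι ∘ inA) (ι ∘ pairedBelow)
                        (λ x → balance-at (inA x) (inA (σ x)) (toℕ x) (toℕ (σ x)))

  ∣A∣≡#inA : ∣ A ∣ ≡ # inA
  ∣A∣≡#inA = trans (cong ∣_∣ (sym (tabulate∘lookup A))) (∣tabulate∣ inA)

  exchange : ∣ Core ∣ + 2 * ∣ Half ∣ + ∣ FixedCore ∣ ≡ 2 * ∣ A ∣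
  exchange
    rewrite ∣tabulate∣ paired | ∣tabulate∣ chosen | ∣tabulate∣ pairedFixed | ∣A∣≡#inA
    = +-cancelʳ-≡ (# pairedBelow) lhs (2 * # inA)
        (trans (cong (lhs +_) (sym #above≡#below)) balance)
    where lhs = # paired + 2 * # chosen + # pairedFixed

weighted-max : ∀ s t → (s + 2 * t ≤ 3 * s) ⊎ (s + 2 * t ≤ 3 * t)
weighted-max s t with ≤-total t s
... | inj₁ t≤s = inj₁ (+-monoʳ-≤ s (*-monoʳ-≤ 2 t≤s))
... | inj₂ s≤t = inj₂ (+-monoˡ-≤ (2 * t) s≤t)

larger-of-two : ∀ a s t e → s + 2 * t + e ≡ 2 * a → e ≤ 1 →
  (2 * a ∸ 1 ≤ 3 * s) ⊎ (2 * a ∸ 1 ≤ 3 * t)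
larger-of-two a s t e sum≡2a e≤1 = Sum.map (≤-trans 2a∸1≤s+2t) (≤-trans 2a∸1≤s+2t) (weighted-max s t)
  where
  2a∸1≤s+2t : 2 * a ∸ 1 ≤ s + 2 * t
  2a∸1≤s+2t = begin
    2 * a ∸ 1         ≤⟨ ∸-monoʳ-≤ (2 * a) e≤1 ⟩
    2 * a ∸ e         ≡⟨ cong (_∸ e) (sym sum≡2a) ⟩
    s + 2 * t + e ∸ e ≡⟨ m+n∸n≡m (s + 2 * t) e ⟩
    s + 2 * t         ∎
    where open ≤-Reasoning

double≡1⇒2 : ∀ r → r < 3 → (2 * r) % 3 ≡ 1 → r ≡ 2
double≡1⇒2 2 _ _ = refl
double≡1⇒2 0 _ ()
double≡1⇒2 1 _ ()
double≡1⇒2 (suc (suc (suc r))) (s≤s (s≤s (s≤s ()))) _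

2a≡1+3m⇒a%3≡2 : ∀ a m → 2 * a ≡ 1 + 3 * m → a % 3 ≡ 2
2a≡1+3m⇒a%3≡2 a m 2a≡1+3m = double≡1⇒2 (a % 3) (m%n<n a 3) (begin
  (2 * (a % 3)) % 3 ≡⟨ sym (%-distribˡ-* 2 a 3) ⟩
  (2 * a) % 3       ≡⟨ cong (_% 3) 2a≡1+3m ⟩
  (1 + 3 * m) % 3   ≡⟨ cong (λ k → (1 + k) % 3) (*-comm 3 m) ⟩
  (1 + m * 3) % 3   ≡⟨ [m+kn]%n≡m%n 1 m 3 ⟩
  1                 ∎)
  where open ≡-Reasoning

-- Since 3m is a multiple of 3, the bound 2a - 1 ≤ 3m rounds up to 2a ≤ 3m
-- unless a ≡ 2 (mod 3).
round-up : ∀ a m → 2 * a ∸ 1 ≤ 3 * m → ¬ (a % 3 ≡ 2) → 2 * a ≤ 3 * m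
round-up a m 2a∸1≤3m a≢2 with m≤n⇒m<n∨m≡n (≤-trans (m≤n+m∸n (2 * a) 1) (+-monoʳ-≤ 1 2a∸1≤3m))
... | inj₁ 2a<1+3m = m<1+n⇒m≤n 2a<1+3m
... | inj₂ 2a≡1+3m = contradiction (2a≡1+3m⇒a%3≡2 a m 2a≡1+3m) a≢2

module _ {q : ℕ} (F : FiniteField q) where
  open FiniteField F renaming (_+_ to _⊕_; _*_ to _⊗_; -_ to ⊖_)
  module R = IsCommutativeRing isCommutativeRing

  fieldRing : CommutativeRing 0ℓ 0ℓ
  fieldRing = record { Carrier = Fin q ; _≈_ = _≡_ ; _+_ = _⊕_ ; _*_ = _⊗_ ; -_ = ⊖_
                     ; 0# = 0# ; 1# = 1# ; isCommutativeRing = isCommutativeRing }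

  open import Algebra.Properties.Ring (CommutativeRing.ring fieldRing)
    using (-‿involutive; +-inverseʳ-unique)

  no-zero-divisors : ∀ a x → ¬ (a ≡ 0#) → a ⊗ x ≡ 0# → x ≡ 0#
  no-zero-divisors a x a≢0 ax≡0 with inverse a a≢0
  ... | b , ab≡1 = begin
    x            ≡⟨ sym (R.*-identityˡ x) ⟩
    1# ⊗ x       ≡⟨ cong (_⊗ x) (sym ab≡1) ⟩
    (a ⊗ b) ⊗ x  ≡⟨ cong (_⊗ x) (R.*-comm a b) ⟩
    (b ⊗ a) ⊗ x  ≡⟨ R.*-assoc b a x ⟩
    b ⊗ (a ⊗ x)  ≡⟨ cong (b ⊗_) ax≡0 ⟩
    b ⊗ 0#       ≡⟨ R.zeroʳ b ⟩
    0#           ∎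
    where open ≡-Reasoning

  double : ∀ x → (1# ⊕ 1#) ⊗ x ≡ x ⊕ x
  double x = trans (R.distribʳ x 1# 1#) (cong₂ _⊕_ (R.*-identityˡ x) (R.*-identityˡ x))

  -- If 2 ≠ 0, then 0 is the only solution of -x = x, as 2x = -x + x = 0.
  neg-fixed⇒0 : ¬ (1# ⊕ 1# ≡ 0#) → ∀ x → ⊖ x ≡ x → x ≡ 0#
  neg-fixed⇒0 2≢0 x -x≡x = no-zero-divisors (1# ⊕ 1#) x 2≢0 (begin
    (1# ⊕ 1#) ⊗ x ≡⟨ double x ⟩
    x ⊕ x         ≡⟨ cong (_⊕ x) (sym -x≡x) ⟩
    ⊖ x ⊕ x       ≡⟨ R.-‿inverseˡ x ⟩
    0#            ∎)
    where open ≡-Reasoning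

  -- If 2 = 0, then x + x = 0 for every x, so negation is the identity.
  char2⇒neg≡id : 1# ⊕ 1# ≡ 0# → ∀ x → ⊖ x ≡ x
  char2⇒neg≡id 2≡0 x =
    sym (+-inverseʳ-unique x x (trans (sym (double x)) (trans (cong (_⊗ x) 2≡0) (R.zeroˡ x))))

  closed⇒Symmetric : ∀ {S : Subset q} → (∀ {x} → x ∈ S → ⊖ x ∈ S) → Symmetric F S
  closed⇒Symmetric {S} closed y =
      (λ y∈S → ⊖ y , closed y∈S , sym (-‿involutive y))
    , (λ { (x , x∈S , y≡-x) → subst (_∈ S) (sym y≡-x) (closed x∈S) })

  disjoint⇒Antisymmetric : ∀ {S : Subset q} → (∀ {x} → x ∈ S → ⊖ x ∈ S → ⊥) → Antisymmetric F S
  disjoint⇒Antisymmetric {S} disjoint y y∈S (x , x∈S , y≡-x) = disjoint x∈S (subst (_∈ S) y≡-x y∈S)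

  LargeSubset : Subset q → Set
  LargeSubset A =
    Σ (Subset q) λ S → S ⊆ A × (Symmetric F S ⊎ Antisymmetric F S) × 2 * ∣ A ∣ ∸ 1 ≤ 3 * ∣ S ∣

  odd-characteristic : (A : Subset q) → ¬ (1# ⊕ 1# ≡ 0#) → LargeSubset A
  odd-characteristic A 2≢0 =
    Sum.[ (λ big → Core , (λ {x} → Core⊆A {x}) , inj₁ (closed⇒Symmetric Core-closed) , big)
        , (λ big → Half , (λ {x} → Half⊆A {x}) , inj₂ (disjoint⇒Antisymmetric Half-disjoint) , big) ]
      (larger-of-two (∣ A ∣) (∣ Core ∣) (∣ Half ∣) (∣ FixedCore ∣) exchange
         (FixedCore-≤1 0# (neg-fixed⇒0 2≢0)))
    where open InvolutionSplit ⊖_ -‿involutive A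

  large-subset : (A : Subset q) → LargeSubset A
  large-subset A with 1# ⊕ 1# ≟ 0#
  ... | no 2≢0  = odd-characteristic A 2≢0
  ... | yes 2≡0 = A , (λ x∈A → x∈A) , inj₁ (closed⇒Symmetric A-closed)
                , ≤-trans (m∸n≤m (2 * ∣ A ∣) 1) (*-monoˡ-≤ ∣ A ∣ (n≤1+n 2))
    where
    A-closed : ∀ {x} → x ∈ A → ⊖ x ∈ A
    A-closed {x} = subst (_∈ A) (sym (char2⇒neg≡id 2≡0 x))

lemma5 : (q : ℕ) (F : FiniteField q) (A : Subset q) →
    (¬ (∣ A ∣ % 3 ≡ 2) →
    Σ (Subset q) λ S → S ⊆ A × (Symmetric F S ⊎ Antisymmetric F S) × 2 * ∣ A ∣ ≤ 3 * ∣ S ∣)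
    × (∣ A ∣ % 3 ≡ 2 →
    Σ (Subset q) λ S → S ⊆ A × (Symmetric F S ⊎ Antisymmetric F S) × 2 * ∣ A ∣ ∸ 1 ≤ 3 * ∣ S ∣)
lemma5 q F A with large-subset F A
... | S , S⊆A , shape , bound =
  (λ |A|≢2 → S , S⊆A , shape , round-up ∣ A ∣ ∣ S ∣ bound |A|≢2) , (λ _ → S , S⊆A , shape , bound)
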